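{- For all $n\geq 0$, $\overline{pl}(4n+3)\equiv 0\pmod 4$.
   Context: A plane overpartition of $n$ is a plane partition of $n$ (an array $(\pi_{ij})_{i,j\geq1}$ of nonnegative integers, weakly decreasing along rows and down columns, with $\sum\pi_{ij}=n$) in which entries may be overlined subject to: in each row, the last occurrence of an integer may be overlined or not and all other occurrences of that integer in the row are not overlined; in each column, the first occurrence of an integer may be overlined or not and all other occurrences of that integer in the column are overlined. $\overline{pl}(n)$ denotes the number of plane overpartitions of $n$; its generating function is $\sum_{n\geq0}\overline{pl}(n)q^n=\prod_{n\geq1}\frac{(1+q^n)^n}{(1-q^n)^n}$. -}

module Defs where

open import Data.Nat using (ℕ; _≤_; _<_; _+_)
open import Data.Bool using (Bool; true; false)
open import Data.Product using (_×_; _,_; proj₁; proj₂)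
open import Data.List using (List; []; _∷_; map)
open import Data.Nat.ListAction using (sum)
open import Data.Empty using (⊥)
open import Data.List.Relation.Unary.All using (All)
open import Data.List.Relation.Unary.Linked using (Linked)
open import Relation.Binary.PropositionalEquality using (_≡_)

Entry : Set
Entry = ℕ × Bool

val : Entry → ℕ
val = proj₁

ovl : Entry → Bool
ovl = proj₂

-- A plane overpartition is stored by its rows (top to bottom), each row listing its
-- nonzero entries left to right; zero entries are not stored (and are never overlined).
PlaneOverpartitionData : Set
PlaneOverpartitionData = List (List Entry)

-- Condition on two horizontally adjacent entries a (left) and b (right) of a row:
-- weakly decreasing, and if they carry the same integer then a is not the last
-- occurrence of that integer in the row, so a is not overlined.
RowStep : Entry → Entry → Set
RowStep a b = (val b ≤ val a) × (val a ≡ val b → ovl a ≡ false)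

ValidRow : List Entry → Set
ValidRow [] = ⊥
ValidRow (e ∷ es) = All (λ x → 0 < val x) (e ∷ es) × Linked RowStep (e ∷ es)

-- The lower row
-- is no longer than the upper one (below a zero there are only zeros), columns weakly
-- decrease, and if two vertically adjacent entries carry the same integer then the
-- lower one is not the first occurrence in its column, hence must be overlined.
data RowBelow : List Entry → List Entry → Set where
  []  : ∀ {r} → RowBelow r []
  _∷_ : ∀ {a b r s} →
        (val b ≤ val a) × (val b ≡ val a → ovl b ≡ true) →
        RowBelow r s → RowBelow (a ∷ r) (b ∷ s)

total : PlaneOverpartitionData → ℕ
total rows = sum (map (λ r → sum (map val r)) rows)

IsPlaneOverpartition : ℕ → PlaneOverpartitionData → Set
IsPlaneOverpartition n π = All ValidRow π × Linked RowBelow π × total π ≡ n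

-- Call a cell free if its overline is not forced by the row and column rules, i.e. it is
-- the last of its value in its row and the first in its column; the overlines of the free
-- cells can be chosen independently.  Let α toggle the overline of the first free cell and
-- β that of the second.  A plane overpartition with a single free cell is a hook filled
-- with one value v, with arm a and leg l, so that v (a + l + 1) = 4n + 3; on those β instead
-- transposes the hook, or, when a = l, swaps the roles of the two odd factors v and 2a + 1.
-- Since 4n + 3 is not a square no hook is fixed, so α and β are commuting involutions
-- without fixed points and with β ≠ α pointwise: the plane overpartitions of 4n + 3 split
-- into orbits of size 4.

module Submission where

open import Defs
open import Data.Nat using (ℕ; _+_; _*_)
open import Data.Nat.Divisibility using (_∣_)
open import Data.List using (List; length)
open import Data.List.Relation.Unary.All using (All)
open import Data.List.Relation.Unary.Unique.Propositional using (Unique)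
open import Data.List.Membership.Propositional using (_∈_)

open import Data.Bool using (Bool; true; false; not; _∧_; _xor_)
open import Data.Bool.Properties using (not-involutive; not-¬; ∧-conicalˡ; ∧-conicalʳ)
import Data.Bool.Properties as Bool
open import Data.Empty using (⊥-elim)
open import Data.List using ([]; _∷_; _++_; _∷ʳ_; map; drop; replicate; filter)
open import Data.List.Properties using (length-replicate; ∷-injectiveˡ; ∷-injectiveʳ; ++-conicalˡ; ++-conicalʳ)
import Data.List.Properties as List
open import Data.List.Membership.Propositional using (_∉_)
open import Data.List.Membership.Propositional.Properties using (∈-filter⁺; ∈-filter⁻; ∈-++⁺ˡ; ∈-++⁺ʳ; ∈-++⁻)
open import Data.List.Membership.Propositional.Properties.WithK using (unique∧set⇒bag)
import Data.List.Membership.DecPropositional as DecMembership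
open import Data.List.Relation.Binary.BagAndSetEquality using (∼bag⇒↭)
open import Data.List.Relation.Binary.Permutation.Propositional using (_↭_)
open import Data.List.Relation.Binary.Permutation.Propositional.Properties using (↭-length)
open import Data.List.Relation.Unary.All using ([]; _∷_; lookup)
import Data.List.Relation.Unary.All.Properties as All
open import Data.List.Relation.Unary.AllPairs using ([]; _∷_)
open import Data.List.Relation.Unary.Any using (here; there)
open import Data.List.Relation.Unary.Linked using (Linked; []; [-]; _∷_)
import Data.List.Relation.Unary.Unique.Propositional.Properties as Unique
open import Data.Maybe using (Maybe; just; nothing)
open import Data.Nat using (zero; suc; _≤_; _<_; _≟_; s≤s; s≤s⁻¹; z≤n; _%_; _/_)
open import Data.Nat.DivMod using (%-distribˡ-*; [m+kn]%n≡m%n; m%n<n; m≡m%n+[m/n]*n; +-distrib-/; m*n/n≡m; m*n%n≡0)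
open import Data.Nat.Divisibility using (divides; ∣m∣n⇒∣m+n; ∣-refl)
open import Data.Nat.Induction using (<-rec)
open import Data.Nat.ListAction using (sum)
open import Data.Nat.Properties using (≤-refl; ≤-antisym; +-comm; +-suc; +-identityʳ; m<n+m)
open import Data.Nat.Tactic.RingSolver using (solve-∀)
open import Data.Product using (_×_; _,_; proj₁; proj₂; ∃; ∃₂)
import Data.Product.Properties as Product
open import Data.Sum using (_⊎_; inj₁; inj₂; [_,_]′)
open import Function using (_∘_; case_of_)
open import Function.Bundles using (mk⇔)
open import Relation.Binary.Definitions using (DecidableEquality)
open import Relation.Binary.PropositionalEquality
open import Relation.Nullary using (yes; no)
open import Relation.Nullary.Decidable using (isNo)

-- Free actions of the Klein four-group

module FreeKleinFourAction
  {A : Set} (_≟_ : DecidableEquality A) (P : A → Set) (α β : A → A)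
  (P-α : ∀ {x} → P x → P (α x)) (P-β : ∀ {x} → P x → P (β x))
  (α-involutive : ∀ {x} → P x → α (α x) ≡ x)
  (β-involutive : ∀ {x} → P x → β (β x) ≡ x)
  (αβ≡βα : ∀ {x} → P x → α (β x) ≡ β (α x))
  (α-fixpoint-free : ∀ {x} → P x → α x ≢ x)
  (β-fixpoint-free : ∀ {x} → P x → β x ≢ x)
  (β≢α : ∀ {x} → P x → β x ≢ α x)
  where

  open DecMembership _≟_ using (_∈?_; _∉?_)

  orbit : A → List A
  orbit x = x ∷ α x ∷ β x ∷ α (β x) ∷ []

  α-injective : ∀ {x y} → P x → P y → α x ≡ α y → x ≡ y
  α-injective px py e = trans (sym (α-involutive px)) (trans (cong α e) (α-involutive py))

  orbit-unique : ∀ {x} → P x → Unique (orbit x)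
  orbit-unique {x} px =
      (x≢αx ∷ x≢βx ∷ x≢αβx ∷ [])
    ∷ (αx≢βx ∷ αx≢αβx ∷ [])
    ∷ (βx≢αβx ∷ [])
    ∷ [] ∷ []
    where
    pβ : P (β x)
    pβ = P-β px
    x≢αx : x ≢ α x
    x≢αx e = α-fixpoint-free px (sym e)
    x≢βx : x ≢ β x
    x≢βx e = β-fixpoint-free px (sym e)
    x≢αβx : x ≢ α (β x)
    x≢αβx e = β≢α px (trans (sym (α-involutive pβ)) (cong α (sym e)))
    αx≢βx : α x ≢ β x
    αx≢βx e = β≢α px (sym e)
    αx≢αβx : α x ≢ α (β x)
    αx≢αβx e = x≢βx (α-injective px pβ e)
    βx≢αβx : β x ≢ α (β x)
    βx≢αβx e = α-fixpoint-free pβ (sym e)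

  orbit-α-closed : ∀ {x y} → P x → y ∈ orbit x → α y ∈ orbit x
  orbit-α-closed px (here refl) = there (here refl)
  orbit-α-closed px (there (here refl)) = here (α-involutive px)
  orbit-α-closed px (there (there (here refl))) = there (there (there (here refl)))
  orbit-α-closed px (there (there (there (here refl)))) = there (there (here (α-involutive (P-β px))))

  orbit-β-closed : ∀ {x y} → P x → y ∈ orbit x → β y ∈ orbit x
  orbit-β-closed px (here refl) = there (there (here refl))
  orbit-β-closed px (there (here refl)) = there (there (there (here (sym (αβ≡βα px)))))
  orbit-β-closed px (there (there (here refl))) = here (β-involutive px)
  orbit-β-closed px (there (there (there (here refl)))) =
    there (here (trans (sym (αβ≡βα (P-β px))) (cong α (β-involutive px))))

  record Closed (L : List A) : Set where
    field
      unique : Unique L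
      valid  : All P L
      α-∈    : ∀ {y} → y ∈ L → α y ∈ L
      β-∈    : ∀ {y} → y ∈ L → β y ∈ L

  module _ {x L} (x∈L : x ∈ L) (inv : Closed L) where
    open Closed inv

    px : P x
    px = lookup valid x∈L

    rest : List A
    rest = filter (_∉? orbit x) L

    ∈-rest⁻ : ∀ {y} → y ∈ rest → y ∈ L × y ∉ orbit x
    ∈-rest⁻ = ∈-filter⁻ (_∉? orbit x) {xs = L}

    orbit⊆L : ∀ {y} → y ∈ orbit x → y ∈ L
    orbit⊆L (here refl) = x∈L
    orbit⊆L (there (here refl)) = α-∈ x∈L
    orbit⊆L (there (there (here refl))) = β-∈ x∈L
    orbit⊆L (there (there (there (here refl)))) = α-∈ (β-∈ x∈L)

    L↭orbit++rest : L ↭ orbit x ++ rest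
    L↭orbit++rest = ∼bag⇒↭ (unique∧set⇒bag unique
      (Unique.++⁺ (orbit-unique px) (Unique.filter⁺ (_∉? orbit x) unique)
                  (λ (y∈o , y∈rest) → proj₂ (∈-rest⁻ y∈rest) y∈o))
      (mk⇔ split ([ orbit⊆L , (proj₁ ∘ ∈-rest⁻) ]′ ∘ ∈-++⁻ (orbit x))))
      where
      split : ∀ {y} → y ∈ L → y ∈ orbit x ++ rest
      split {y} y∈L with y ∈? orbit x
      ... | yes y∈o = ∈-++⁺ˡ y∈o
      ... | no y∉o = ∈-++⁺ʳ (orbit x) (∈-filter⁺ (_∉? orbit x) y∈L y∉o)

    Closed-rest : Closed rest
    Closed-rest = record
      { unique = Unique.filter⁺ (_∉? orbit x) unique
      ; valid  = All.filter⁺ (_∉? orbit x) valid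
      ; α-∈    = rest-closed-under α α-∈ (orbit-α-closed px) α-involutive
      ; β-∈    = rest-closed-under β β-∈ (orbit-β-closed px) β-involutive
      }
      where
      rest-closed-under : (γ : A → A) → (∀ {y} → y ∈ L → γ y ∈ L) → (∀ {y} → y ∈ orbit x → γ y ∈ orbit x) →
              (∀ {y} → P y → γ (γ y) ≡ y) → ∀ {y} → y ∈ rest → γ y ∈ rest
      rest-closed-under γ γ-∈ γ-orbit γγ y∈rest with ∈-rest⁻ y∈rest
      ... | y∈L , y∉o = ∈-filter⁺ (_∉? orbit x) (γ-∈ y∈L)
                          (λ γy∈o → y∉o (subst (_∈ orbit x) (γγ (lookup valid y∈L)) (γ-orbit γy∈o)))

  4∣length : ∀ {L} → Closed L → 4 ∣ length L
  4∣length {L} = <-rec Goal step (length L) refl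
    where
    Goal : ℕ → Set
    Goal n = ∀ {L} → length L ≡ n → Closed L → 4 ∣ n

    step : ∀ n → (∀ {m} → m < n → Goal m) → Goal n
    step n rec {[]} refl inv = divides 0 refl
    step n rec {x ∷ L} refl inv =
      subst (4 ∣_) (sym length≡) (∣m∣n⇒∣m+n ∣-refl (rec shorter refl (Closed-rest x∈xL inv)))
      where
      x∈xL : x ∈ x ∷ L
      x∈xL = here refl
      length≡ : length (x ∷ L) ≡ 4 + length (rest x∈xL inv)
      length≡ = ↭-length (L↭orbit++rest x∈xL inv)
      shorter : length (rest x∈xL inv) < length (x ∷ L)
      shorter = subst (length (rest x∈xL inv) <_) (sym length≡) (m<n+m _ (s≤s z≤n))

-- Arithmetic of 4n + 3

square%4≡0⊎1 : ∀ v → v * v % 4 ≡ 0 ⊎ v * v % 4 ≡ 1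
square%4≡0⊎1 v = subst (λ k → k ≡ 0 ⊎ k ≡ 1) (sym (%-distribˡ-* v v 4)) (residue (v % 4) (m%n<n v 4))
  where
  residue : ∀ r → r < 4 → r * r % 4 ≡ 0 ⊎ r * r % 4 ≡ 1
  residue 0 _ = inj₁ refl
  residue 1 _ = inj₂ refl
  residue 2 _ = inj₁ refl
  residue 3 _ = inj₂ refl
  residue (suc (suc (suc (suc _)))) (s≤s (s≤s (s≤s (s≤s ()))))

[4n+3]%4≡3 : ∀ n → (4 * n + 3) % 4 ≡ 3
[4n+3]%4≡3 n = trans (cong (_% 4) (shape n)) ([m+kn]%n≡m%n 3 n 4)
  where
  shape : ∀ n → 4 * n + 3 ≡ 3 + n * 4
  shape = solve-∀

[4n+3]%2≡1 : ∀ n → (4 * n + 3) % 2 ≡ 1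
[4n+3]%2≡1 n = trans (cong (_% 2) (shape n)) ([m+kn]%n≡m%n 1 (2 * n + 1) 2)
  where
  shape : ∀ n → 4 * n + 3 ≡ 1 + (2 * n + 1) * 2
  shape = solve-∀

4n+3-nonsquare : ∀ n v → v * v ≢ 4 * n + 3
4n+3-nonsquare n v eq with square%4≡0⊎1 v | trans (cong (_% 4) eq) ([4n+3]%4≡3 n)
... | inj₁ sq≡0 | sq≡3 = case trans (sym sq≡0) sq≡3 of λ ()
... | inj₂ sq≡1 | sq≡3 = case trans (sym sq≡1) sq≡3 of λ ()

factor-of-4n+3-odd : ∀ n v w → v * w ≡ 4 * n + 3 → v ≡ 1 + v / 2 * 2
factor-of-4n+3-odd n v w eq
  with v % 2 | m%n<n v 2 | m≡m%n+[m/n]*n v 2 | %-distribˡ-* v w 2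
... | 1 | _ | v≡ | _ = v≡
... | 0 | _ | _ | vw%2≡0 = case trans (sym vw%2≡0) (trans (cong (_% 2) eq) ([4n+3]%2≡1 n)) of λ ()
... | suc (suc _) | s≤s (s≤s ()) | _ | _

[1+2a]/2≡a : ∀ a → (1 + a * 2) / 2 ≡ a
[1+2a]/2≡a a =
  trans (+-distrib-/ 1 (a * 2) (subst (λ r → 1 + r < 2) (sym (m*n%n≡0 a 2)) ≤-refl)) (m*n/n≡m a 2)

-- Free cells and toggling their overlines

values : List Entry → List ℕ
values = map val

differsFromHead : ℕ → List ℕ → Bool
differsFromHead x []      = true
differsFromHead x (y ∷ _) = isNo (x ≟ y)

differsFromHead⇒≢ : ∀ {x y ys} → differsFromHead x (y ∷ ys) ≡ true → x ≢ y
differsFromHead⇒≢ {x} {y} h with x ≟ y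
differsFromHead⇒≢ () | yes _
differsFromHead⇒≢ _  | no x≢y = x≢y

-- 'above' lists the values of the row above from the cell's column on, 'rest' the values
-- to the right of the cell.
isFree : List ℕ → ℕ → List ℕ → Bool
isFree above x rest = differsFromHead x rest ∧ differsFromHead x above

differsFromHead-self : ∀ x xs → differsFromHead x (x ∷ xs) ≡ false
differsFromHead-self x xs with x ≟ x
... | yes _  = refl
... | no x≢x = ⊥-elim (x≢x refl)

freeRow : List ℕ → List ℕ → List Bool
freeRow above []       = []
freeRow above (x ∷ xs) = isFree above x xs ∷ freeRow (drop 1 above) xs

freeRows : List ℕ → List (List ℕ) → List (List Bool)
freeRows above []       = []
freeRows above (r ∷ rs) = freeRow above r ∷ freeRows r rs

freeCells : PlaneOverpartitionData → List (List Bool)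
freeCells π = freeRows [] (map values π)

overlinesAt : List Bool → List Entry → List Bool
overlinesAt _            []      = []
overlinesAt []           (_ ∷ _) = []
overlinesAt (true  ∷ fs) (e ∷ r) = ovl e ∷ overlinesAt fs r
overlinesAt (false ∷ fs) (e ∷ r) = overlinesAt fs r

overlinesAtRows : List (List Bool) → PlaneOverpartitionData → List Bool
overlinesAtRows _         []      = []
overlinesAtRows []        (_ ∷ _) = []
overlinesAtRows (fs ∷ F)  (r ∷ π) = overlinesAt fs r ++ overlinesAtRows F π

freeOverlines : PlaneOverpartitionData → List Bool
freeOverlines π = overlinesAtRows (freeCells π) π

-- just k: flip the k-th of the free cells still to come; nothing: flip nothing (more).
Cursor : Set
Cursor = Maybe ℕ

atCursor : Cursor → Bool
atCursor (just zero) = true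
atCursor _           = false

advance : Cursor → Cursor
advance (just (suc k)) = just k
advance _              = nothing

passCell : Bool → Cursor → Cursor
passCell true  c = advance c
passCell false c = c

flipIf : Bool → Entry → Entry
flipIf b e = val e , b xor ovl e

flipRow : List Bool → Cursor → List Entry → List Entry
flipRow _        c []      = []
flipRow []       c (e ∷ r) = e ∷ r
flipRow (f ∷ fs) c (e ∷ r) = flipIf (f ∧ atCursor c) e ∷ flipRow fs (passCell f c) r

cursorAfterRow : List Bool → Cursor → List Entry → Cursor
cursorAfterRow _        c []      = c
cursorAfterRow []       c (_ ∷ _) = c
cursorAfterRow (f ∷ fs) c (_ ∷ r) = cursorAfterRow fs (passCell f c) r

flipRows : List (List Bool) → Cursor → PlaneOverpartitionData → PlaneOverpartitionData
flipRows _        c []      = []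
flipRows []       c (r ∷ π) = r ∷ π
flipRows (fs ∷ F) c (r ∷ π) = flipRow fs c r ∷ flipRows F (cursorAfterRow fs c r) π

flipFree : ℕ → PlaneOverpartitionData → PlaneOverpartitionData
flipFree k π = flipRows (freeCells π) (just k) π

toggleAt : Cursor → List Bool → List Bool
toggleAt nothing        bs       = bs
toggleAt (just _)       []       = []
toggleAt (just zero)    (b ∷ bs) = not b ∷ bs
toggleAt (just (suc k)) (b ∷ bs) = b ∷ toggleAt (just k) bs

cursorAfter : Cursor → List Bool → Cursor
cursorAfter c []       = c
cursorAfter c (_ ∷ bs) = cursorAfter (advance c) bs

flipIf-involutive : ∀ b e → flipIf b (flipIf b e) ≡ e
flipIf-involutive false e = refl
flipIf-involutive true  e = cong (val e ,_) (not-involutive (ovl e))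

flipIf-comm : ∀ b c e → flipIf b (flipIf c e) ≡ flipIf c (flipIf b e)
flipIf-comm false c     e = refl
flipIf-comm true  false e = refl
flipIf-comm true  true  e = refl

values-flipRow : ∀ fs c r → values (flipRow fs c r) ≡ values r
values-flipRow _        c []      = refl
values-flipRow []       c (e ∷ r) = refl
values-flipRow (f ∷ fs) c (e ∷ r) = cong (val e ∷_) (values-flipRow fs (passCell f c) r)

values-flipRows : ∀ F c π → map values (flipRows F c π) ≡ map values π
values-flipRows _        c []      = refl
values-flipRows []       c (r ∷ π) = refl
values-flipRows (fs ∷ F) c (r ∷ π) =
  cong₂ _∷_ (values-flipRow fs c r) (values-flipRows F (cursorAfterRow fs c r) π)

cursorAfterRow-flipRow : ∀ fs c c′ r → cursorAfterRow fs c (flipRow fs c′ r) ≡ cursorAfterRow fs c r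
cursorAfterRow-flipRow _        c c′ []      = refl
cursorAfterRow-flipRow []       c c′ (e ∷ r) = refl
cursorAfterRow-flipRow (f ∷ fs) c c′ (e ∷ r) = cursorAfterRow-flipRow fs (passCell f c) (passCell f c′) r

flipRow-involutive : ∀ fs c r → flipRow fs c (flipRow fs c r) ≡ r
flipRow-involutive _        c []      = refl
flipRow-involutive []       c (e ∷ r) = refl
flipRow-involutive (f ∷ fs) c (e ∷ r) =
  cong₂ _∷_ (flipIf-involutive (f ∧ atCursor c) e) (flipRow-involutive fs (passCell f c) r)

flipRows-involutive : ∀ F c π → flipRows F c (flipRows F c π) ≡ π
flipRows-involutive _        c []      = refl
flipRows-involutive []       c (r ∷ π) = refl
flipRows-involutive (fs ∷ F) c (r ∷ π) rewrite cursorAfterRow-flipRow fs c c r =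
  cong₂ _∷_ (flipRow-involutive fs c r) (flipRows-involutive F (cursorAfterRow fs c r) π)

flipRow-comm : ∀ fs c c′ r → flipRow fs c (flipRow fs c′ r) ≡ flipRow fs c′ (flipRow fs c r)
flipRow-comm _        c c′ []      = refl
flipRow-comm []       c c′ (e ∷ r) = refl
flipRow-comm (f ∷ fs) c c′ (e ∷ r) =
  cong₂ _∷_ (flipIf-comm (f ∧ atCursor c) (f ∧ atCursor c′) e)
            (flipRow-comm fs (passCell f c) (passCell f c′) r)

flipRows-comm : ∀ F c c′ π → flipRows F c (flipRows F c′ π) ≡ flipRows F c′ (flipRows F c π)
flipRows-comm _        c c′ []      = refl
flipRows-comm []       c c′ (r ∷ π) = refl
flipRows-comm (fs ∷ F) c c′ (r ∷ π)
  rewrite cursorAfterRow-flipRow fs c c′ r | cursorAfterRow-flipRow fs c′ c r =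
  cong₂ _∷_ (flipRow-comm fs c c′ r)
            (flipRows-comm F (cursorAfterRow fs c r) (cursorAfterRow fs c′ r) π)

flipRow-nothing : ∀ fs r → flipRow fs nothing r ≡ r
flipRow-nothing _            []      = refl
flipRow-nothing []           (e ∷ r) = refl
flipRow-nothing (false ∷ fs) (e ∷ r) = cong (e ∷_) (flipRow-nothing fs r)
flipRow-nothing (true  ∷ fs) (e ∷ r) = cong (e ∷_) (flipRow-nothing fs r)

cursorAfterRow-nothing : ∀ fs r → cursorAfterRow fs nothing r ≡ nothing
cursorAfterRow-nothing _            []      = refl
cursorAfterRow-nothing []           (e ∷ r) = refl
cursorAfterRow-nothing (false ∷ fs) (e ∷ r) = cursorAfterRow-nothing fs r
cursorAfterRow-nothing (true  ∷ fs) (e ∷ r) = cursorAfterRow-nothing fs r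

flipRows-nothing : ∀ F π → flipRows F nothing π ≡ π
flipRows-nothing _        []      = refl
flipRows-nothing []       (r ∷ π) = refl
flipRows-nothing (fs ∷ F) (r ∷ π) rewrite cursorAfterRow-nothing fs r =
  cong₂ _∷_ (flipRow-nothing fs r) (flipRows-nothing F π)

cursorAfter-nothing : ∀ bs → cursorAfter nothing bs ≡ nothing
cursorAfter-nothing []       = refl
cursorAfter-nothing (_ ∷ bs) = cursorAfter-nothing bs

toggleAt-++ : ∀ c bs bs′ → toggleAt c (bs ++ bs′) ≡ toggleAt c bs ++ toggleAt (cursorAfter c bs) bs′
toggleAt-++ nothing        bs       bs′ rewrite cursorAfter-nothing bs = refl
toggleAt-++ (just _)       []       bs′ = refl
toggleAt-++ (just zero)    (b ∷ bs) bs′ rewrite cursorAfter-nothing bs = refl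
toggleAt-++ (just (suc k)) (b ∷ bs) bs′ = cong (b ∷_) (toggleAt-++ (just k) bs bs′)

overlinesAt-flipRow : ∀ fs c r → overlinesAt fs (flipRow fs c r) ≡ toggleAt c (overlinesAt fs r)
overlinesAt-flipRow fs           nothing        r       rewrite flipRow-nothing fs r = refl
overlinesAt-flipRow _            (just _)       []      = refl
overlinesAt-flipRow []           (just _)       (e ∷ r) = refl
overlinesAt-flipRow (false ∷ fs) (just k)       (e ∷ r) = overlinesAt-flipRow fs (just k) r
overlinesAt-flipRow (true  ∷ fs) (just zero)    (e ∷ r) rewrite flipRow-nothing fs r = refl
overlinesAt-flipRow (true  ∷ fs) (just (suc k)) (e ∷ r) = cong (ovl e ∷_) (overlinesAt-flipRow fs (just k) r)

cursorAfterRow≡cursorAfter : ∀ fs c r → cursorAfterRow fs c r ≡ cursorAfter c (overlinesAt fs r)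
cursorAfterRow≡cursorAfter _            c []      = refl
cursorAfterRow≡cursorAfter []           c (e ∷ r) = refl
cursorAfterRow≡cursorAfter (false ∷ fs) c (e ∷ r) = cursorAfterRow≡cursorAfter fs c r
cursorAfterRow≡cursorAfter (true  ∷ fs) c (e ∷ r) = cursorAfterRow≡cursorAfter fs (advance c) r

overlinesAtRows-flipRows : ∀ F c π → overlinesAtRows F (flipRows F c π) ≡ toggleAt c (overlinesAtRows F π)
overlinesAtRows-flipRows F        nothing  π       rewrite flipRows-nothing F π = refl
overlinesAtRows-flipRows _        (just _) []      = refl
overlinesAtRows-flipRows []       (just _) (r ∷ π) = refl
overlinesAtRows-flipRows (fs ∷ F) (just k) (r ∷ π)
  rewrite overlinesAt-flipRow fs (just k) r
        | overlinesAtRows-flipRows F (cursorAfterRow fs (just k) r) π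
        | toggleAt-++ (just k) (overlinesAt fs r) (overlinesAtRows F π)
        | cursorAfterRow≡cursorAfter fs (just k) r = refl

freeCells-flipFree : ∀ k π → freeCells (flipFree k π) ≡ freeCells π
freeCells-flipFree k π = cong (freeRows []) (values-flipRows (freeCells π) (just k) π)

flipFree-involutive : ∀ k π → flipFree k (flipFree k π) ≡ π
flipFree-involutive k π rewrite freeCells-flipFree k π = flipRows-involutive (freeCells π) (just k) π

flipFree-comm : ∀ j k π → flipFree j (flipFree k π) ≡ flipFree k (flipFree j π)
flipFree-comm j k π rewrite freeCells-flipFree k π | freeCells-flipFree j π =
  flipRows-comm (freeCells π) (just j) (just k) π

freeOverlines-flipFree : ∀ k π → freeOverlines (flipFree k π) ≡ toggleAt (just k) (freeOverlines π)
freeOverlines-flipFree k π rewrite freeCells-flipFree k π = overlinesAtRows-flipRows (freeCells π) (just k) π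

-- Toggling preserves plane overpartitions

ColumnStep : Entry → Entry → Set
ColumnStep a b = (val b ≤ val a) × (val b ≡ val a → ovl b ≡ true)

-- Only free cells get flipped, and the rules constrain the overline of non-free cells only.
flagged⇒lastInRow : ∀ above x y ys c → isFree above x (y ∷ ys) ∧ atCursor c ≡ true → x ≢ y
flagged⇒lastInRow above x y ys c h =
  differsFromHead⇒≢ {ys = ys} (∧-conicalˡ _ (differsFromHead x above) (∧-conicalˡ _ (atCursor c) h))

flagged⇒firstInColumn : ∀ y above x ys c → isFree (y ∷ above) x ys ∧ atCursor c ≡ true → x ≢ y
flagged⇒firstInColumn y above x ys c h =
  differsFromHead⇒≢ {ys = above} (∧-conicalʳ (differsFromHead x ys) _ (∧-conicalˡ _ (atCursor c) h))

flipIf-RowStep : ∀ p q a b → (p ≡ true → val a ≢ val b) → RowStep a b →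
                 RowStep (flipIf p a) (flipIf q b)
flipIf-RowStep false q a b _    step      = step
flipIf-RowStep true  q a b last (b≤a , _) = b≤a , λ a≡b → ⊥-elim (last refl a≡b)

flipIf-ColumnStep : ∀ p q a b → (q ≡ true → val b ≢ val a) → ColumnStep a b →
                    ColumnStep (flipIf p a) (flipIf q b)
flipIf-ColumnStep p false a b _     step      = step
flipIf-ColumnStep p true  a b first (b≤a , _) = b≤a , λ b≡a → ⊥-elim (first refl b≡a)

flipRow-RowSteps : ∀ above c r → Linked RowStep r →
                   Linked RowStep (flipRow (freeRow above (values r)) c r)
flipRow-RowSteps above c []           _              = []
flipRow-RowSteps above c (e ∷ [])     _              = [-]
flipRow-RowSteps above c (e ∷ e′ ∷ r) (step ∷ steps) =
  flipIf-RowStep _ (isFree (drop 1 above) (val e′) (values r) ∧ atCursor c′) e e′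
                 (flagged⇒lastInRow above (val e) (val e′) (values r) c) step
  ∷ flipRow-RowSteps (drop 1 above) c′ (e′ ∷ r) steps
  where
  c′ : Cursor
  c′ = passCell (isFree above (val e) (values (e′ ∷ r))) c

flipRow-valid : ∀ above c r → ValidRow r → ValidRow (flipRow (freeRow above (values r)) c r)
flipRow-valid above c (e ∷ r) (positive , steps) =
  All.map⁻ (subst (All (0 <_)) (sym (values-flipRow (freeRow above (values (e ∷ r))) c (e ∷ r)))
                  (All.map⁺ positive)) ,
  flipRow-RowSteps above c (e ∷ r) steps

flipRows-valid : ∀ above c π → All ValidRow π →
                 All ValidRow (flipRows (freeRows above (map values π)) c π)
flipRows-valid above c []      []         = []
flipRows-valid above c (r ∷ π) (valid ∷ valids) =
  flipRow-valid above c r valid ∷ flipRows-valid (values r) _ π valids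

flipRow-RowBelow : ∀ above c c′ u r → RowBelow u r →
  RowBelow (flipRow (freeRow above (values u)) c u) (flipRow (freeRow (values u) (values r)) c′ r)
flipRow-RowBelow above c c′ u       []      []       = []
flipRow-RowBelow above c c′ (a ∷ u) (b ∷ r) (step ∷ below) =
  flipIf-ColumnStep (isFree above (val a) (values u) ∧ atCursor c) _ a b
                    (flagged⇒firstInColumn (val a) (values u) (val b) (values r) c′) step
  ∷ flipRow-RowBelow (drop 1 above) (passCell (isFree above (val a) (values u)) c)
                     (passCell (isFree (values (a ∷ u)) (val b) (values r)) c′) u r below

flipRows-RowBelow : ∀ above c π → Linked RowBelow π →
                    Linked RowBelow (flipRows (freeRows above (map values π)) c π)
flipRows-RowBelow above c []           _              = []
flipRows-RowBelow above c (r ∷ [])     _              = [-]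
flipRows-RowBelow above c (r ∷ r′ ∷ π) (below ∷ belows) =
  flipRow-RowBelow above c _ r r′ below ∷ flipRows-RowBelow (values r) _ (r′ ∷ π) belows

total-flipRows : ∀ F c π → total (flipRows F c π) ≡ total π
total-flipRows _        c []      = refl
total-flipRows []       c (r ∷ π) = refl
total-flipRows (fs ∷ F) c (r ∷ π) =
  cong₂ _+_ (cong sum (values-flipRow fs c r)) (total-flipRows F (cursorAfterRow fs c r) π)

flipFree-valid : ∀ {N} k π → IsPlaneOverpartition N π → IsPlaneOverpartition N (flipFree k π)
flipFree-valid k π (valid , below , total≡) =
  flipRows-valid [] (just k) π valid , flipRows-RowBelow [] (just k) π below ,
  trans (total-flipRows (freeCells π) (just k) π) total≡

-- Hooks

HookShape : Set
HookShape = ℕ × ℕ × ℕ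

size : HookShape → ℕ
size (v , a , l) = v * suc (a + l)

hookArm : ℕ → ℕ → Bool → List Entry
hookArm v zero    b = (v , b) ∷ []
hookArm v (suc a) b = (v , false) ∷ hookArm v a b

hookLeg : ℕ → ℕ → PlaneOverpartitionData
hookLeg v l = replicate l ((v , true) ∷ [])

hook : HookShape → Bool → PlaneOverpartitionData
hook (v , a , l) b = hookArm v a b ∷ hookLeg v l

shapeOf : PlaneOverpartitionData → HookShape
shapeOf ((e ∷ r) ∷ rs) = val e , length r , length rs
shapeOf _              = 0 , 0 , 0

length-hookArm : ∀ v a b → length (hookArm v a b) ≡ suc a
length-hookArm v zero    b = refl
length-hookArm v (suc a) b = cong suc (length-hookArm v a b)

shapeOf-hook : ∀ s b → shapeOf (hook s b) ≡ s
shapeOf-hook (v , zero  , l) b = cong (λ l′ → v , 0 , l′) (length-replicate l)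
shapeOf-hook (v , suc a , l) b = cong₂ (λ a′ l′ → v , a′ , l′) (length-hookArm v a b) (length-replicate l)

differsFromHead-hookArm : ∀ v a b → differsFromHead v (values (hookArm v a b)) ≡ false
differsFromHead-hookArm v zero    b = differsFromHead-self v []
differsFromHead-hookArm v (suc a) b = differsFromHead-self v (values (hookArm v a b))

freeRow-hookArm : ∀ v a b → freeRow [] (values (hookArm v a b)) ≡ replicate a false ∷ʳ true
freeRow-hookArm v zero    b = refl
freeRow-hookArm v (suc a) b rewrite differsFromHead-hookArm v a b = cong (false ∷_) (freeRow-hookArm v a b)

freeRows-hookLeg : ∀ v l above → differsFromHead v above ≡ false →
                   freeRows above (map values (hookLeg v l)) ≡ replicate l (false ∷ [])
freeRows-hookLeg v zero    above _    = refl
freeRows-hookLeg v (suc l) above same rewrite same =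
  cong ((false ∷ []) ∷_) (freeRows-hookLeg v l (v ∷ []) (differsFromHead-self v []))

freeCells-hook : ∀ v a l b →
                 freeCells (hook (v , a , l) b) ≡ (replicate a false ∷ʳ true) ∷ replicate l (false ∷ [])
freeCells-hook v a l b =
  cong₂ _∷_ (freeRow-hookArm v a b) (freeRows-hookLeg v l _ (differsFromHead-hookArm v a b))

freeOverlines-hook : ∀ s b → freeOverlines (hook s b) ≡ b ∷ []
freeOverlines-hook (v , a , l) b =
  trans (cong (λ F → overlinesAtRows F (hook (v , a , l) b)) (freeCells-hook v a l b))
        (cong₂ _++_ (arm a) (leg l))
  where
  arm : ∀ a → overlinesAt (replicate a false ∷ʳ true) (hookArm v a b) ≡ b ∷ []
  arm zero    = refl
  arm (suc a) = arm a
  leg : ∀ l → overlinesAtRows (replicate l (false ∷ [])) (hookLeg v l) ≡ []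
  leg zero    = refl
  leg (suc l) = leg l

flipFree-hook : ∀ s b → flipFree 0 (hook s b) ≡ hook s (not b)
flipFree-hook (v , a , l) b =
  trans (cong (λ F → flipRows F (just 0) (hook (v , a , l) b)) (freeCells-hook v a l b))
        (cong₂ _∷_ (arm a) (trans (cong (λ c → flipRows _ c (hookLeg v l)) (cursorAfterRow-arm a))
                                  (flipRows-nothing _ (hookLeg v l))))
  where
  arm : ∀ a → flipRow (replicate a false ∷ʳ true) (just 0) (hookArm v a b) ≡ hookArm v a (not b)
  arm zero    = refl
  arm (suc a) = cong ((v , false) ∷_) (arm a)
  cursorAfterRow-arm : ∀ a → cursorAfterRow (replicate a false ∷ʳ true) (just 0) (hookArm v a b) ≡ nothing
  cursorAfterRow-arm zero    = refl
  cursorAfterRow-arm (suc a) = cursorAfterRow-arm a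

total-hook : ∀ s b → total (hook s b) ≡ size s
total-hook (v , a , l) b = trans (cong₂ _+_ (arm a) (leg l)) (shape a l v)
  where
  arm : ∀ a → sum (values (hookArm v a b)) ≡ suc a * v
  arm zero    = refl
  arm (suc a) = cong (v +_) (arm a)
  leg : ∀ l → total (hookLeg v l) ≡ l * v
  leg zero    = refl
  leg (suc l) = cong₂ _+_ (+-identityʳ v) (leg l)
  shape : ∀ a l v → suc a * v + l * v ≡ v * suc (a + l)
  shape = solve-∀

hook-valid : ∀ s b → 0 < proj₁ s → IsPlaneOverpartition (size s) (hook s b)
hook-valid (v , a , l) b 0<v = (arm-valid a ∷ leg-valid l) , below l , total-hook (v , a , l) b
  where
  arm-positive : ∀ a → All (λ x → 0 < val x) (hookArm v a b)
  arm-positive zero    = 0<v ∷ []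
  arm-positive (suc a) = 0<v ∷ arm-positive a
  arm-steps : ∀ a → Linked RowStep (hookArm v a b)
  arm-steps zero          = [-]
  arm-steps (suc zero)    = (≤-refl , λ _ → refl) ∷ [-]
  arm-steps (suc (suc a)) = (≤-refl , λ _ → refl) ∷ arm-steps (suc a)
  arm-valid : ∀ a → ValidRow (hookArm v a b)
  arm-valid zero    = arm-positive zero , arm-steps zero
  arm-valid (suc a) = arm-positive (suc a) , arm-steps (suc a)
  leg-valid : ∀ l → All ValidRow (hookLeg v l)
  leg-valid zero    = []
  leg-valid (suc l) = ((0<v ∷ []) , [-]) ∷ leg-valid l
  corner : ∀ a → RowBelow (hookArm v a b) ((v , true) ∷ [])
  corner zero    = (≤-refl , λ _ → refl) ∷ []
  corner (suc a) = (≤-refl , λ _ → refl) ∷ []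
  leg-below : ∀ l → Linked RowBelow (hookLeg v (suc l))
  leg-below zero    = [-]
  leg-below (suc l) = ((≤-refl , λ _ → refl) ∷ []) ∷ leg-below l
  below : ∀ l → Linked RowBelow (hook (v , a , l) b)
  below zero    = [-]
  below (suc l) = corner a ∷ leg-below l

conjugate : HookShape → HookShape
conjugate (v , a , l) with a ≟ l
... | yes _ = 1 + a * 2 , v / 2 , v / 2   -- v is odd on hooks of size 4n + 3, so v / 2 = (v − 1) / 2
... | no _  = v , l , a

conjugate-symmetric : ∀ v a → conjugate (v , a , a) ≡ (1 + a * 2 , v / 2 , v / 2)
conjugate-symmetric v a with a ≟ a
... | yes _  = refl
... | no a≢a = ⊥-elim (a≢a refl)

conjugate-asymmetric : ∀ {v a l} → a ≢ l → conjugate (v , a , l) ≡ (v , l , a)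
conjugate-asymmetric {v} {a} {l} a≢l with a ≟ l
... | yes a≡l = ⊥-elim (a≢l a≡l)
... | no _    = refl

module _ (n : ℕ) where
  open ≡-Reasoning

  conjugate-size : ∀ s → size s ≡ 4 * n + 3 → size (conjugate s) ≡ 4 * n + 3
  conjugate-size (v , a , l) eq with a ≟ l
  ... | no _ = trans (cong (λ k → v * suc k) (+-comm l a)) eq
  ... | yes refl = begin
    (1 + a * 2) * suc (v / 2 + v / 2)   ≡⟨ swap a (v / 2) ⟩
    (1 + v / 2 * 2) * suc (a + a)       ≡⟨ cong (_* suc (a + a)) (sym (factor-of-4n+3-odd n v _ eq)) ⟩
    v * suc (a + a)                     ≡⟨ eq ⟩
    4 * n + 3                           ∎
    where
    swap : ∀ a h → (1 + a * 2) * suc (h + h) ≡ (1 + h * 2) * suc (a + a)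
    swap = solve-∀

  conjugate-involutive : ∀ s → size s ≡ 4 * n + 3 → conjugate (conjugate s) ≡ s
  conjugate-involutive (v , a , l) eq with a ≟ l
  ... | no a≢l = conjugate-asymmetric (a≢l ∘ sym)
  ... | yes refl = begin
    conjugate (1 + a * 2 , v / 2 , v / 2)               ≡⟨ conjugate-symmetric (1 + a * 2) (v / 2) ⟩
    (1 + v / 2 * 2 , (1 + a * 2) / 2 , (1 + a * 2) / 2) ≡⟨ cong₂ (λ w h → w , h , h)
                                                             (sym (factor-of-4n+3-odd n v _ eq)) ([1+2a]/2≡a a) ⟩
    (v , a , a)                                         ∎

  conjugate-fixpoint-free : ∀ s → size s ≡ 4 * n + 3 → conjugate s ≢ s
  conjugate-fixpoint-free (v , a , l) eq with a ≟ l
  ... | no a≢l = λ e → a≢l (sym (cong (proj₁ ∘ proj₂) e))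
  ... | yes refl = λ e → 4n+3-nonsquare n v (begin
    v * v               ≡⟨ cong (v *_) (sym (cong proj₁ e)) ⟩
    v * (1 + a * 2)     ≡⟨ cong (v *_) (odd a) ⟩
    v * suc (a + a)     ≡⟨ eq ⟩
    4 * n + 3           ∎)
    where
    odd : ∀ a → 1 + a * 2 ≡ suc (a + a)
    odd = solve-∀

-- Plane overpartitions with at most one free cell

rowFreeOverlines : List ℕ → List Entry → List Bool
rowFreeOverlines above r = overlinesAt (freeRow above (values r)) r

freeOverlinesBelow : List Entry → PlaneOverpartitionData → List Bool
freeOverlinesBelow u rs = overlinesAtRows (freeRows (values u) (map values rs)) rs

topRowOverlines-nonempty : ∀ e r → ∃₂ λ c cs → rowFreeOverlines [] (e ∷ r) ≡ c ∷ cs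
topRowOverlines-nonempty e []       = ovl e , [] , refl
topRowOverlines-nonempty e (e′ ∷ r) with val e ≟ val e′
... | yes _ = topRowOverlines-nonempty e′ r
... | no _  = ovl e , _ , refl

topRow-oneFree⇒hookArm : ∀ e r {c} → Linked RowStep (e ∷ r) →
                         rowFreeOverlines [] (e ∷ r) ≡ c ∷ [] →
                         ∃ λ a → e ∷ r ≡ hookArm (val e) a c
topRow-oneFree⇒hookArm e [] _ refl = 0 , refl
topRow-oneFree⇒hookArm e (e′ ∷ r) (step ∷ steps) one with val e ≟ val e′
... | no _ with c′ , cs , more ← topRowOverlines-nonempty e′ r =
  case trans (sym more) (∷-injectiveʳ one) of λ ()
... | yes e≡e′ with a , arm ← topRow-oneFree⇒hookArm e′ r steps one =
  suc a , cong₂ _∷_ (cong (val e ,_) (proj₂ step e≡e′))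
                    (trans arm (cong (λ v → hookArm v a _) (sym e≡e′)))

Constant : ℕ → List Entry → Set
Constant v = All (λ x → val x ≡ v)

hookArm-constant : ∀ v a b → Constant v (hookArm v a b)
hookArm-constant v zero    b = refl ∷ []
hookArm-constant v (suc a) b = refl ∷ hookArm-constant v a b

overlinesAt-tail≡[] : ∀ f fs e r → overlinesAt (f ∷ fs) (e ∷ r) ≡ [] → overlinesAt fs r ≡ []
overlinesAt-tail≡[] false fs e r none = none

-- The last cell is not free, so it equals the value above it; monotonicity does the rest.
noFreeBelowConstant⇒constant : ∀ v u r → Constant v u → RowBelow u r → Linked RowStep r →
                                rowFreeOverlines (values u) r ≡ [] → Constant v r
noFreeBelowConstant⇒constant v u       []           _         _               _    _ = []
noFreeBelowConstant⇒constant v (a ∷ u) (c ∷ [])     (a≡v ∷ _) (step ∷ _)      _ none with val c ≟ val a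
... | yes c≡a = trans c≡a a≡v ∷ []
noFreeBelowConstant⇒constant v (a ∷ u) (c ∷ [])     (a≡v ∷ _) (step ∷ _)      _ () | no _
noFreeBelowConstant⇒constant v (a ∷ u) (c ∷ c′ ∷ r) (a≡v ∷ u≡v) (step ∷ below) (rowStep ∷ rowSteps) none
  with noFreeBelowConstant⇒constant v u (c′ ∷ r) u≡v below rowSteps
         (overlinesAt-tail≡[] (isFree (values (a ∷ u)) (val c) (values (c′ ∷ r))) _ c (c′ ∷ r) none)
... | c′≡v ∷ rest =
  ≤-antisym (subst (val c ≤_) a≡v (proj₁ step)) (subst (_≤ val c) c′≡v (proj₁ rowStep)) ∷ c′≡v ∷ rest

-- A second cell would force the first to be overlined (column rule) and not (row rule).
constantBelowConstant⇒corner : ∀ v u r → Constant v u → RowBelow u r → ValidRow r → Constant v r →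
                                r ≡ (v , true) ∷ []
constantBelowConstant⇒corner v (a ∷ u) (c ∷ []) (a≡v ∷ _) (step ∷ _) _ (c≡v ∷ []) =
  cong (_∷ []) (cong₂ _,_ c≡v (proj₂ step (trans c≡v (sym a≡v))))
constantBelowConstant⇒corner v (a ∷ u) (c ∷ c′ ∷ r) (a≡v ∷ _) (step ∷ _) (_ , (rowStep ∷ _))
                             (c≡v ∷ c′≡v ∷ _)
  with () ← trans (sym (proj₂ rowStep (trans c≡v (sym c′≡v)))) (proj₂ step (trans c≡v (sym a≡v)))

ValidRow⇒RowSteps : ∀ {r} → ValidRow r → Linked RowStep r
ValidRow⇒RowSteps {_ ∷ _} (_ , steps) = steps

rowsBelowConstant⇒hookLeg : ∀ v u rs → Constant v u → All ValidRow rs → Linked RowBelow (u ∷ rs) →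
                             freeOverlinesBelow u rs ≡ [] →
                             ∃ λ l → rs ≡ hookLeg v l
rowsBelowConstant⇒hookLeg v u []       _   _               _                _    = 0 , refl
rowsBelowConstant⇒hookLeg v u (r ∷ rs) u≡v (valid ∷ valids) (below ∷ belows) none
  with constantBelowConstant⇒corner v u r u≡v below valid
         (noFreeBelowConstant⇒constant v u r u≡v below (ValidRow⇒RowSteps valid) (++-conicalˡ _ _ none))
... | refl with l , leg ← rowsBelowConstant⇒hookLeg v ((v , true) ∷ []) rs (refl ∷ []) valids belows
                                                    (++-conicalʳ _ _ none) =
  suc l , cong (((v , true) ∷ []) ∷_) leg

++-length≤0 : ∀ {A : Set} (xs ys : List A) → length (xs ++ ys) ≤ 0 → xs ≡ [] × ys ≡ []
++-length≤0 [] [] _ = refl , refl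

fewFreeOverlines⇒hook : ∀ {N} π → IsPlaneOverpartition (suc N) π → length (freeOverlines π) ≤ 1 →
                        ∃₂ λ s b → π ≡ hook s b
fewFreeOverlines⇒hook []             (_ , _ , ())
fewFreeOverlines⇒hook ([] ∷ _)       ((() ∷ _) , _)
fewFreeOverlines⇒hook ((e ∷ r) ∷ rs) ((valid ∷ valids) , belows , _) few
  with c , cs , top ← topRowOverlines-nonempty e r
  with refl , rest≡[] ← ++-length≤0 cs (freeOverlinesBelow (e ∷ r) rs)
                           (s≤s⁻¹ (subst (λ bs → length (bs ++ freeOverlinesBelow (e ∷ r) rs) ≤ 1) top few))
  with a , arm ← topRow-oneFree⇒hookArm e r (ValidRow⇒RowSteps valid) top
  with l , leg ← rowsBelowConstant⇒hookLeg (val e) (e ∷ r) rs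
                   (subst (Constant (val e)) (sym arm) (hookArm-constant (val e) a c))
                   valids belows rest≡[] =
  (val e , a , l) , c , cong₂ _∷_ arm leg

-- The involutions α and β

hook-injectiveˡ : ∀ {s s′ b b′} → hook s b ≡ hook s′ b′ → s ≡ s′
hook-injectiveˡ {s} {s′} {b} {b′} eq =
  trans (sym (shapeOf-hook s b)) (trans (cong shapeOf eq) (shapeOf-hook s′ b′))

hook-injectiveʳ : ∀ {s s′ b b′} → hook s b ≡ hook s′ b′ → b ≡ b′
hook-injectiveʳ {s} {s′} {b} {b′} eq = ∷-injectiveˡ
  (trans (sym (freeOverlines-hook s b)) (trans (cong freeOverlines eq) (freeOverlines-hook s′ b′)))

data FreeOverlinesView : PlaneOverpartitionData → Set where
  twoOrMore : ∀ {π} b₁ b₂ bs → freeOverlines π ≡ b₁ ∷ b₂ ∷ bs → FreeOverlinesView π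
  isHook    : ∀ s b → FreeOverlinesView (hook s b)

freeOverlinesView : ∀ {N} π → IsPlaneOverpartition (suc N) π → FreeOverlinesView π
freeOverlinesView π p with freeOverlines π in eq
... | b₁ ∷ b₂ ∷ bs = twoOrMore b₁ b₂ bs eq
... | b ∷ [] with s , b′ , refl ← fewFreeOverlines⇒hook π p (subst (λ bs → length bs ≤ 1) (sym eq) ≤-refl) =
  isHook s b′
... | []     with s , b′ , refl ← fewFreeOverlines⇒hook π p (subst (λ bs → length bs ≤ 1) (sym eq) z≤n) =
  isHook s b′

α : PlaneOverpartitionData → PlaneOverpartitionData
α = flipFree 0

βWith : List Bool → PlaneOverpartitionData → PlaneOverpartitionData
βWith (_ ∷ _ ∷ _) π = flipFree 1 π
βWith (b ∷ [])    π = hook (conjugate (shapeOf π)) b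
βWith []          π = π   -- never used: every nonempty plane overpartition has a free cell

β : PlaneOverpartitionData → PlaneOverpartitionData
β π = βWith (freeOverlines π) π

β-twoOrMore : ∀ π {b₁ b₂ bs} → freeOverlines π ≡ b₁ ∷ b₂ ∷ bs → β π ≡ flipFree 1 π
β-twoOrMore π eq = cong (λ bs → βWith bs π) eq

β-hook : ∀ s b → β (hook s b) ≡ hook (conjugate s) b
β-hook s b rewrite freeOverlines-hook s b | shapeOf-hook s b = refl

module Involutions (n : ℕ) where
  open ≡-Reasoning

  IsPO : PlaneOverpartitionData → Set
  IsPO = IsPlaneOverpartition (4 * n + 3)

  view : ∀ π → IsPO π → FreeOverlinesView π
  view π p = freeOverlinesView π (subst (λ N → IsPlaneOverpartition N π) (+-suc (4 * n) 2) p)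

  hook-size : ∀ {s b} → IsPO (hook s b) → size s ≡ 4 * n + 3
  hook-size {s} {b} (_ , _ , total≡) = trans (sym (total-hook s b)) total≡

  size-value-positive : ∀ s → size s ≡ 4 * n + 3 → 0 < proj₁ s
  size-value-positive (zero  , _) eq with () ← trans eq (+-comm (4 * n) 3)
  size-value-positive (suc v , _) _  = s≤s z≤n

  freeOverlines-α : ∀ π {b₁ b₂ bs} → freeOverlines π ≡ b₁ ∷ b₂ ∷ bs →
                    freeOverlines (α π) ≡ not b₁ ∷ b₂ ∷ bs
  freeOverlines-α π eq = trans (freeOverlines-flipFree 0 π) (cong (toggleAt (just 0)) eq)

  freeOverlines-flipFree1 : ∀ π {b₁ b₂ bs} → freeOverlines π ≡ b₁ ∷ b₂ ∷ bs →
                            freeOverlines (flipFree 1 π) ≡ b₁ ∷ not b₂ ∷ bs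
  freeOverlines-flipFree1 π eq = trans (freeOverlines-flipFree 1 π) (cong (toggleAt (just 1)) eq)

  α-valid : ∀ {π} → IsPO π → IsPO (α π)
  α-valid {π} = flipFree-valid 0 π

  β-valid : ∀ {π} → IsPO π → IsPO (β π)
  β-valid {π} p with view π p
  ... | twoOrMore _ _ _ eq = subst IsPO (sym (β-twoOrMore π eq)) (flipFree-valid 1 π p)
  ... | isHook s b =
    subst IsPO (sym (β-hook s b))
          (subst (λ N → IsPlaneOverpartition N (hook (conjugate s) b)) size≡
                 (hook-valid (conjugate s) b (size-value-positive (conjugate s) size≡)))
    where
    size≡ : size (conjugate s) ≡ 4 * n + 3
    size≡ = conjugate-size n s (hook-size p)

  α-involutive : ∀ {π} → IsPO π → α (α π) ≡ π
  α-involutive {π} _ = flipFree-involutive 0 π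

  β-involutive : ∀ {π} → IsPO π → β (β π) ≡ π
  β-involutive {π} p with view π p
  ... | twoOrMore _ _ _ eq = begin
    β (β π)                  ≡⟨ cong β (β-twoOrMore π eq) ⟩
    β (flipFree 1 π)         ≡⟨ β-twoOrMore (flipFree 1 π) (freeOverlines-flipFree1 π eq) ⟩
    flipFree 1 (flipFree 1 π) ≡⟨ flipFree-involutive 1 π ⟩
    π                        ∎
  ... | isHook s b = begin
    β (β (hook s b))                     ≡⟨ cong β (β-hook s b) ⟩
    β (hook (conjugate s) b)             ≡⟨ β-hook (conjugate s) b ⟩
    hook (conjugate (conjugate s)) b     ≡⟨ cong (λ s′ → hook s′ b) (conjugate-involutive n s (hook-size p)) ⟩
    hook s b                             ∎

  αβ≡βα : ∀ {π} → IsPO π → α (β π) ≡ β (α π)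
  αβ≡βα {π} p with view π p
  ... | twoOrMore _ _ _ eq = begin
    α (β π)                   ≡⟨ cong α (β-twoOrMore π eq) ⟩
    flipFree 0 (flipFree 1 π) ≡⟨ flipFree-comm 0 1 π ⟩
    flipFree 1 (α π)          ≡⟨ β-twoOrMore (α π) (freeOverlines-α π eq) ⟨
    β (α π)                   ∎
  ... | isHook s b = begin
    α (β (hook s b))              ≡⟨ cong α (β-hook s b) ⟩
    α (hook (conjugate s) b)      ≡⟨ flipFree-hook (conjugate s) b ⟩
    hook (conjugate s) (not b)    ≡⟨ β-hook s (not b) ⟨
    β (hook s (not b))            ≡⟨ cong β (flipFree-hook s b) ⟨
    β (α (hook s b))              ∎

  α-fixpoint-free : ∀ {π} → IsPO π → α π ≢ π
  α-fixpoint-free {π} p απ≡π with view π p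
  ... | twoOrMore b₁ _ _ eq =
    not-¬ refl (sym (∷-injectiveˡ (trans (sym (freeOverlines-α π eq)) (trans (cong freeOverlines απ≡π) eq))))
  ... | isHook s b = not-¬ refl (sym (hook-injectiveʳ (trans (sym (flipFree-hook s b)) απ≡π)))

  β-fixpoint-free : ∀ {π} → IsPO π → β π ≢ π
  β-fixpoint-free {π} p βπ≡π with view π p
  ... | twoOrMore b₁ b₂ _ eq =
    not-¬ refl (sym (∷-injectiveˡ (∷-injectiveʳ (trans (sym (freeOverlines-flipFree1 π eq))
      (trans (cong freeOverlines (trans (sym (β-twoOrMore π eq)) βπ≡π)) eq)))))
  ... | isHook s b =
    conjugate-fixpoint-free n s (hook-size p) (hook-injectiveˡ (trans (sym (β-hook s b)) βπ≡π))

  β≢α : ∀ {π} → IsPO π → β π ≢ α π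
  β≢α {π} p βπ≡απ with view π p
  ... | twoOrMore b₁ _ _ eq =
    not-¬ refl (∷-injectiveˡ (trans (sym (freeOverlines-flipFree1 π eq))
      (trans (cong freeOverlines (trans (sym (β-twoOrMore π eq)) βπ≡απ)) (freeOverlines-α π eq))))
  ... | isHook s b = not-¬ refl (hook-injectiveʳ (trans (sym (β-hook s b)) (trans βπ≡απ (flipFree-hook s b))))

_≟PO_ : DecidableEquality PlaneOverpartitionData
_≟PO_ = List.≡-dec (List.≡-dec (Product.≡-dec _≟_ Bool._≟_))

corollary3p1 : (n : ℕ) (L : List PlaneOverpartitionData) →
               Unique L →
               All (IsPlaneOverpartition (4 * n + 3)) L →
               (∀ π → IsPlaneOverpartition (4 * n + 3) π → π ∈ L) →
               4 ∣ length L
corollary3p1 n L unique valid complete = 4∣length record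
  { unique = unique
  ; valid  = valid
  ; α-∈    = λ π∈L → complete _ (α-valid (lookup valid π∈L))
  ; β-∈    = λ π∈L → complete _ (β-valid (lookup valid π∈L))
  }
  where
  open Involutions n
  open FreeKleinFourAction _≟PO_ IsPO α β α-valid β-valid α-involutive β-involutive
                           αβ≡βα α-fixpoint-free β-fixpoint-free β≢α
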